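{- Let $q$ be a prime power, $n$ a positive integer, $\alpha,\beta,\gamma,\bar\alpha,\bar\beta,\bar\gamma\in\mathbb{F}_{q^n}^*$, and $I\ne J$ nonnegative integers with $I,J<n-1$, such that $U_{\alpha,\beta,\gamma}^{I,J,n}$ and $U_{\bar\alpha,\bar\beta,\bar\gamma}^{I,J,n}$ are both scattered. Let $K:=J-I$ and let $\rho,\nu\in\mathbb{F}_{q^n}$ be the unique elements with $$\rho^{q^K}=\Big(\tfrac{\beta}{\bar\beta}\Big)^{q^{K-I}}\Big(\tfrac{\bar\alpha}{\alpha}\Big)^{q^{ -I}},\qquad \nu^{q^K}=\Big(\tfrac{\gamma\bar\alpha}{\bar\gamma\alpha}\Big)^{q^{ -I}}.$$ If $\rho=\nu^{q^K+1}$ and $\nu$ is a $(q^K-1)$-th power in $\mathbb{F}_{q^n}$, then $U_{\alpha,\beta,\gamma}^{I,J,n}$ and $U_{\bar\alpha,\bar\beta,\bar\gamma}^{I,J,n}$ are $\Gamma\mathrm{L}(4,q^n)$-equivalent.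
   Context: For $a,b,c\in\mathbb{F}_{q^n}^*$, $U_{a,b,c}^{I,J,n}:=\{(x,\,y,\,x^{q^I}+a y^{q^J},\,x^{q^J}+b y^{q^I}+c y^{q^J}) : x,y\in\mathbb{F}_{q^n}\}\subseteq\mathbb{F}_{q^n}^4$. An $\mathbb{F}_q$-subspace $U$ of $\mathbb{F}_{q^n}^4$ is scattered if $\dim_{\mathbb{F}_q}(U\cap H)\le1$ for every $1$-dimensional $\mathbb{F}_{q^n}$-subspace $H$. For any integer $t$ (possibly negative) and $z\in\mathbb{F}_{q^n}$, $z^{q^t}$ denotes $\varphi^t(z)$ with $\varphi:z\mapsto z^q$ the Frobenius automorphism of $\mathbb{F}_{q^n}$; $z^{q^t+1}:=z^{q^t}z$, and "$\nu$ is a $(q^K-1)$-th power" means $\nu=w^{q^K}/w$ for some $w\in\mathbb{F}_{q^n}^*$. Two $\mathbb{F}_q$-subspaces $U_1,U_2$ of $\mathbb{F}_{q^n}^4$ are $\Gamma\mathrm{L}(4,q^n)$-equivalent if there exist a field automorphism $\tau$ of $\mathbb{F}_{q^n}$ and $N\in\mathrm{GL}(4,\mathbb{F}_{q^n})$ with $U_2=\{Nu^\tau : u\in U_1\}$ (columns, $\tau$ acting coordinatewise). -}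

module Defs where

open import Level using (0ℓ)
open import Data.Nat as ℕ using (ℕ; zero; suc; _≤_; _∸_)
open import Data.Integer as ℤ using (ℤ; +_; -[1+_])
open import Data.Fin using (Fin)
open import Data.Vec using (Vec; []; _∷_; map; zipWith; foldr; replicate; transpose)
open import Data.Product using (Σ; ∃; ∃₂; _×_; _,_)
open import Data.Sum using (_⊎_)
open import Relation.Nullary using (¬_)
open import Relation.Binary.PropositionalEquality using (_≡_)
open import Function.Bundles using (_↔_)
open import Algebra.Structures using (IsCommutativeRing)
open import Data.Nat.Primality using (Prime)

PrimePower : ℕ → Set
PrimePower q = ∃₂ λ p e → Prime p × 1 ≤ e × q ≡ p ℕ.^ e

record FiniteField (q n : ℕ) : Set₁ where
  infixl 6 _+_
  infixl 7 _*_
  field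
    F    : Set
    _+_  : F → F → F
    _*_  : F → F → F
    -_   : F → F
    0#   : F
    1#   : F
    _⁻¹  : F → F
    isCommutativeRing : IsCommutativeRing _≡_ _+_ _*_ -_ 0# 1#
    0≢1  : ¬ (0# ≡ 1#)
    ⁻¹-inverse : ∀ x → ¬ (x ≡ 0#) → x * (x ⁻¹) ≡ 1#
    card : F ↔ Fin (q ℕ.^ n)

module FF {q n : ℕ} (𝔽 : FiniteField q n) where
  open FiniteField 𝔽 public

  _/_ : F → F → F
  x / y = x * (y ⁻¹)

  pow : F → ℕ → F
  pow x zero    = 1#
  pow x (suc m) = x * pow x m

  φ : F → F
  φ z = pow z q

  φ^ : ℕ → F → F
  φ^ zero    z = z
  φ^ (suc k) z = φ (φ^ k z)

  -- z^{q^t} := φ^t(z) for an integer t.  Since φ^n = id on F_{q^n},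
  -- φ^{-(k+1)} = φ^{(k+1)(n-1)}.
  frob : ℤ → F → F
  frob (+ k)      z = φ^ k z
  frob -[1+ k ]   z = φ^ (suc k ℕ.* (n ∸ 1)) z

  V4 : Set
  V4 = Vec F 4

  0v : V4
  0v = replicate 4 0#

  _·_ : F → V4 → V4
  λ' · v = map (λ' *_) v

  dot : V4 → V4 → F
  dot u v = foldr _ _+_ 0# (zipWith _*_ u v)

  Mat : Set
  Mat = Vec V4 4

  _⊙_ : Mat → V4 → V4
  N ⊙ v = map (λ row → dot row v) N

  _⊗_ : Mat → Mat → Mat
  A ⊗ B = map (λ row → map (λ col → dot row col) (transpose B)) A

  Id4 : Mat
  Id4 = (1# ∷ 0# ∷ 0# ∷ 0# ∷ []) ∷ (0# ∷ 1# ∷ 0# ∷ 0# ∷ []) ∷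
        (0# ∷ 0# ∷ 1# ∷ 0# ∷ []) ∷ (0# ∷ 0# ∷ 0# ∷ 1# ∷ []) ∷ []

  Invertible : Mat → Set
  Invertible N = ∃ λ M → (N ⊗ M ≡ Id4) × (M ⊗ N ≡ Id4)

  IsFieldAut : (F → F) → Set
  IsFieldAut τ = (∀ x y → τ (x + y) ≡ τ x + τ y) × (∀ x y → τ (x * y) ≡ τ x * τ y)
               × (τ 1# ≡ 1#) × (∃ λ (σ : F → F) → (∀ x → σ (τ x) ≡ x) × (∀ x → τ (σ x) ≡ x))

  Subset4 : Set₁
  Subset4 = V4 → Set

  U : F → F → F → ℕ → ℕ → Subset4
  U a b c I J v = ∃₂ λ x y →
    v ≡ x ∷ y ∷ (φ^ I x + a * φ^ J y) ∷ (φ^ J x + b * φ^ I y + c * φ^ J y) ∷ []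

  InFq : F → Set
  InFq μ = φ μ ≡ μ

  -- scattered: for every 1-dim F_{q^n}-subspace H = ⟨v⟩ (v ≠ 0),
  -- dim_{F_q}(U ∩ H) ≤ 1, i.e. any two elements of U ∩ H are F_q-dependent
  -- (every element is an F_q-multiple of any nonzero one).
  Scattered : Subset4 → Set
  Scattered W = ∀ (v : V4) → ¬ (v ≡ 0v) → ∀ u₁ u₂ →
    W u₁ → W u₂ → (∃ λ λ₁ → u₁ ≡ λ₁ · v) → (∃ λ λ₂ → u₂ ≡ λ₂ · v) →
    (u₁ ≡ 0v) ⊎ (∃ λ μ → InFq μ × u₂ ≡ μ · u₁)

  ΓLEquivalent : Subset4 → Subset4 → Set
  ΓLEquivalent U₁ U₂ = ∃₂ λ (τ : F → F) (N : Mat) → IsFieldAut τ × Invertible N ×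
    (∀ u → U₁ u → U₂ (N ⊙ map τ u)) ×
    (∀ w → U₂ w → ∃ λ u → U₁ u × w ≡ N ⊙ map τ u)

{-# OPTIONS --safe #-}
-- The equivalence is realised with τ = id and N = diag(κ, μ, κ^{q^I}, κ^{q^J}), which sends the
-- point of U_{α,β,γ} with parameters (x, y) to the point of U_{α̅,β̅,γ̅} with parameters (κx, μy)
-- as soon as
--   κ^{q^I} α = α̅ μ^{q^J},   κ^{q^J} β = β̅ μ^{q^I},   κ^{q^J} γ = γ̅ μ^{q^J}.
-- With ν = w^{q^K}/w, take κ = w^{-q^K} and μ = (α/α̅)^{q^{-J}}/w: the first equation then holds
-- outright, the third is the defining equation of ν raised to q^I, and the second, raised to q^J,
-- is ρ = ν^{q^K+1} raised to q^{2I}. Negative Frobenius exponents make sense because z^{q^n} = z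
-- (Fermat: z ↦ az permutes F, so the products of all nonzero elements before and after scaling
-- agree, giving a^{q^n} = a).
module Submission where

open import Defs
open import Level using (0ℓ)
open import Data.Nat as ℕ using (ℕ; zero; suc; _<_; _∸_; _≤_)
import Data.Nat.Properties as ℕ
open import Data.Integer as ℤ using (ℤ; +_; -[1+_]) renaming (_-_ to _-ℤ_; -_ to negℤ)
import Data.Integer.Properties as ℤ
open import Data.Integer.Tactic.RingSolver using (solve-∀)
open import Data.Fin as Fin using (Fin; zero; suc)
open import Data.Fin.Properties using (punchInᵢ≢i)
open import Data.Fin.Permutation using (Permutation; _⟨$⟩ʳ_)
open import Data.Vec.Functional using (removeAt; rearrange)
open import Data.Vec using (Vec; []; _∷_; map; zipWith; foldr; replicate; lookup; transpose; _[_]≔_)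
open import Data.Fin.Patterns using (0F; 1F; 2F; 3F)
open import Data.Vec.Properties using (map-cong; zipWith-comm)
open import Data.Product using (∃; _×_; _,_)
open import Data.Empty using (⊥-elim)
open import Relation.Nullary using (¬_; yes; no)
open import Relation.Nullary.Decidable using (via-injection)
open import Relation.Binary.Definitions using (DecidableEquality)
open import Relation.Binary.PropositionalEquality
open import Function.Base using (_∘_; id)
open import Function.Bundles using (Inverse; mk↔ₛ′)
open import Function.Properties.Inverse using (↔⇒↣)
open import Function.Construct.Composition using (_↔-∘_)
open import Function.Construct.Symmetry using (↔-sym)
open import Algebra.Bundles using (CommutativeMonoid)
open import Algebra.Structures using (IsCommutativeRing)

module FieldProperties {q n : ℕ} (𝔽 : FiniteField q n) where
  open FF 𝔽
  open IsCommutativeRing isCommutativeRing public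
    using (zeroˡ; zeroʳ; +-identityˡ; +-identityʳ; *-assoc; *-comm; *-identityˡ; *-identityʳ; distribˡ; *-isCommutativeMonoid)
  open ≡-Reasoning

  *-commutativeMonoid : CommutativeMonoid 0ℓ 0ℓ
  *-commutativeMonoid = record { isCommutativeMonoid = *-isCommutativeMonoid }

  open import Algebra.Solver.CommutativeMonoid *-commutativeMonoid public
    using (solve; _⊕_; _⊜_)

  ⁻¹-inverseˡ : ∀ {x} → ¬ x ≡ 0# → x ⁻¹ * x ≡ 1#
  ⁻¹-inverseˡ {x} x≢0 = trans (*-comm (x ⁻¹) x) (⁻¹-inverse x x≢0)

  *-cancelʳ : ∀ {x y z} → ¬ z ≡ 0# → x * z ≡ y * z → x ≡ y
  *-cancelʳ {x} {y} {z} z≢0 eq = begin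
    x                ≡⟨ sym (*-identityʳ x) ⟩
    x * 1#           ≡⟨ cong (x *_) (sym (⁻¹-inverse z z≢0)) ⟩
    x * (z * z ⁻¹)   ≡⟨ sym (*-assoc x z (z ⁻¹)) ⟩
    x * z * z ⁻¹     ≡⟨ cong (_* z ⁻¹) eq ⟩
    y * z * z ⁻¹     ≡⟨ *-assoc y z (z ⁻¹) ⟩
    y * (z * z ⁻¹)   ≡⟨ cong (y *_) (⁻¹-inverse z z≢0) ⟩
    y * 1#           ≡⟨ *-identityʳ y ⟩
    y                ∎

  x*y≢0 : ∀ {x y} → ¬ x ≡ 0# → ¬ y ≡ 0# → ¬ x * y ≡ 0#
  x*y≢0 {x} {y} x≢0 y≢0 xy≡0 = y≢0 (*-cancelʳ {y} {0#} x≢0 (begin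
    y * x   ≡⟨ *-comm y x ⟩
    x * y   ≡⟨ xy≡0 ⟩
    0#      ≡⟨ sym (zeroˡ x) ⟩
    0# * x  ∎))

  ⁻¹≢0 : ∀ {x} → ¬ x ≡ 0# → ¬ x ⁻¹ ≡ 0#
  ⁻¹≢0 {x} x≢0 x⁻¹≡0 = 0≢1 (begin
    0#          ≡⟨ sym (zeroʳ x) ⟩
    x * 0#      ≡⟨ cong (x *_) (sym x⁻¹≡0) ⟩
    x * x ⁻¹    ≡⟨ ⁻¹-inverse x x≢0 ⟩
    1#          ∎)

  *-⁻¹-cancelˡ : ∀ {c} → ¬ c ≡ 0# → ∀ x → c * (c ⁻¹ * x) ≡ x
  *-⁻¹-cancelˡ {c} c≢0 x = trans (sym (*-assoc c _ x)) (trans (cong (_* x) (⁻¹-inverse c c≢0)) (*-identityˡ x))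

  ⁻¹-*-cancelˡ : ∀ {c} → ¬ c ≡ 0# → ∀ x → c ⁻¹ * (c * x) ≡ x
  ⁻¹-*-cancelˡ {c} c≢0 x = trans (sym (*-assoc _ c x)) (trans (cong (_* x) (⁻¹-inverseˡ c≢0)) (*-identityˡ x))

  ⁻¹-*-cancelʳ : ∀ {c} → ¬ c ≡ 0# → ∀ x → x * c ⁻¹ * c ≡ x
  ⁻¹-*-cancelʳ {c} c≢0 x = trans (*-assoc x _ c) (trans (cong (x *_) (⁻¹-inverseˡ c≢0)) (*-identityʳ x))

  pow-1# : ∀ m → pow 1# m ≡ 1#
  pow-1# zero    = refl
  pow-1# (suc m) = trans (*-identityˡ _) (pow-1# m)

  pow-distrib-* : ∀ x y m → pow (x * y) m ≡ pow x m * pow y m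
  pow-distrib-* x y zero    = sym (*-identityˡ 1#)
  pow-distrib-* x y (suc m) = trans (cong (x * y *_) (pow-distrib-* x y m))
    (solve 4 (λ a b c d → (a ⊕ b) ⊕ (c ⊕ d) ⊜ (a ⊕ c) ⊕ (b ⊕ d)) refl x y (pow x m) (pow y m))

  pow-+ : ∀ x a b → pow x (a ℕ.+ b) ≡ pow x a * pow x b
  pow-+ x zero    b = sym (*-identityˡ _)
  pow-+ x (suc a) b = trans (cong (x *_) (pow-+ x a b)) (sym (*-assoc x _ _))

  pow-* : ∀ x a b → pow x (a ℕ.* b) ≡ pow (pow x a) b
  pow-* x zero    b = sym (pow-1# b)
  pow-* x (suc a) b = begin
    pow x (b ℕ.+ a ℕ.* b)       ≡⟨ pow-+ x b (a ℕ.* b) ⟩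
    pow x b * pow x (a ℕ.* b)   ≡⟨ cong (pow x b *_) (pow-* x a b) ⟩
    pow x b * pow (pow x a) b   ≡⟨ sym (pow-distrib-* x (pow x a) b) ⟩
    pow (x * pow x a) b         ∎

  φ^-pow : ∀ k x → φ^ k x ≡ pow x (q ℕ.^ k)
  φ^-pow zero    x = sym (*-identityʳ x)
  φ^-pow (suc k) x = begin
    pow (φ^ k x) q              ≡⟨ cong (λ y → pow y q) (φ^-pow k x) ⟩
    pow (pow x (q ℕ.^ k)) q     ≡⟨ sym (pow-* x (q ℕ.^ k) q) ⟩
    pow x (q ℕ.^ k ℕ.* q)       ≡⟨ cong (pow x) (ℕ.*-comm (q ℕ.^ k) q) ⟩
    pow x (q ℕ.^ suc k)         ∎

  φ^-+ : ∀ a b x → φ^ a (φ^ b x) ≡ φ^ (a ℕ.+ b) x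
  φ^-+ zero    b x = refl
  φ^-+ (suc a) b x = cong φ (φ^-+ a b x)

  φ^-comm : ∀ a b x → φ^ a (φ^ b x) ≡ φ^ b (φ^ a x)
  φ^-comm a b x = begin
    φ^ a (φ^ b x)   ≡⟨ φ^-+ a b x ⟩
    φ^ (a ℕ.+ b) x  ≡⟨ cong (λ m → φ^ m x) (ℕ.+-comm a b) ⟩
    φ^ (b ℕ.+ a) x  ≡⟨ sym (φ^-+ b a x) ⟩
    φ^ b (φ^ a x)   ∎

  φ^-* : ∀ k x y → φ^ k (x * y) ≡ φ^ k x * φ^ k y
  φ^-* zero    x y = refl
  φ^-* (suc k) x y = trans (cong φ (φ^-* k x y)) (pow-distrib-* _ _ q)

  φ^-1# : ∀ k → φ^ k 1# ≡ 1#
  φ^-1# zero    = refl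
  φ^-1# (suc k) = trans (cong φ (φ^-1# k)) (pow-1# q)

  φ^-*-≡ : ∀ k {x y z} → x * y ≡ z → φ^ k x * φ^ k y ≡ φ^ k z
  φ^-*-≡ k {x} {y} eq = trans (sym (φ^-* k x y)) (cong (φ^ k) eq)

  φ^-⁻¹-inverseˡ : ∀ k {x} → ¬ x ≡ 0# → φ^ k (x ⁻¹) * φ^ k x ≡ 1#
  φ^-⁻¹-inverseˡ k x≢0 = trans (φ^-*-≡ k (⁻¹-inverseˡ x≢0)) (φ^-1# k)

  φ^≢0 : ∀ k {x} → ¬ x ≡ 0# → ¬ φ^ k x ≡ 0#
  φ^≢0 k {x} x≢0 φx≡0 = 0≢1 (begin
    0#                       ≡⟨ sym (zeroʳ _) ⟩
    φ^ k (x ⁻¹) * 0#         ≡⟨ cong (φ^ k (x ⁻¹) *_) (sym φx≡0) ⟩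
    φ^ k (x ⁻¹) * φ^ k x     ≡⟨ φ^-⁻¹-inverseˡ k x≢0 ⟩
    1#                       ∎)


module FermatLittleTheorem {q n : ℕ} (𝔽 : FiniteField q n) where
  open FF 𝔽
  open FieldProperties 𝔽
  open Inverse card using (to; from; strictlyInverseˡ; strictlyInverseʳ)
  open ≡-Reasoning
  open import Algebra.Properties.CommutativeMonoid.Sum *-commutativeMonoid
    using (sum-cong-≗; sum-remove; sum-permute; ∑-distrib-+)
    renaming (sum to prod)

  _≟_ : DecidableEquality F
  _≟_ = via-injection (↔⇒↣ card) Fin._≟_

  prod-const : ∀ m a → prod {m} (λ _ → a) ≡ pow a m
  prod-const zero    a = refl
  prod-const (suc m) a = cong (a *_) (prod-const m a)

  prod≢0 : ∀ {m} (t : Fin m → F) → (∀ i → ¬ t i ≡ 0#) → ¬ prod t ≡ 0#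
  prod≢0 {zero}  t t≢0 1≡0 = 0≢1 (sym 1≡0)
  prod≢0 {suc m} t t≢0 = x*y≢0 (t≢0 zero) (prod≢0 (t ∘ suc) (t≢0 ∘ suc))

  prod-agree-off : ∀ {m} (t u : Fin m → F) (i : Fin m) →
                   (∀ j → ¬ j ≡ i → t j ≡ u j) → u i * prod t ≡ t i * prod u
  prod-agree-off {suc m} t u i t≗u = begin
    u i * prod t                          ≡⟨ cong (u i *_) (sum-remove t) ⟩
    u i * (t i * prod (removeAt t i))     ≡⟨ solve 3 (λ a b c → a ⊕ (b ⊕ c) ⊜ b ⊕ (a ⊕ c)) refl (u i) (t i) _ ⟩
    t i * (u i * prod (removeAt t i))     ≡⟨ cong (λ r → t i * (u i * r)) (sum-cong-≗ λ j → t≗u _ (punchInᵢ≢i i j)) ⟩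
    t i * (u i * prod (removeAt u i))     ≡⟨ cong (t i *_) (sym (sum-remove u)) ⟩
    t i * prod u                          ∎

  ∏ : (F → F) → F
  ∏ f = prod (λ i → f (from i))

  ∏-scale : ∀ {a} → ¬ a ≡ 0# → (f : F → F) → ∏ (λ y → f (a * y)) ≡ ∏ f
  ∏-scale {a} a≢0 f = begin
    ∏ (λ y → f (a * y))                           ≡⟨ sum-cong-≗ (λ i → cong f (sym (strictlyInverseʳ (a * from i)))) ⟩
    prod (rearrange (scaling ⟨$⟩ʳ_) (f ∘ from))   ≡⟨ sym (sum-permute (f ∘ from) scaling) ⟩
    ∏ f                                           ∎
    where
    scaling : Permutation (q ℕ.^ n) (q ℕ.^ n)
    scaling = card ↔-∘ (mk↔ₛ′ (a *_) (a ⁻¹ *_) (*-⁻¹-cancelˡ a≢0) (⁻¹-*-cancelˡ a≢0) ↔-∘ ↔-sym card)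

  ∏-agree-off-zero : (f g : F → F) → (∀ y → ¬ y ≡ 0# → f y ≡ g y) → g 0# * ∏ f ≡ f 0# * ∏ g
  ∏-agree-off-zero f g f≗g = begin
    g 0# * ∏ f                       ≡⟨ cong (λ z → g z * ∏ f) (sym from-to0) ⟩
    g (from (to 0#)) * ∏ f           ≡⟨ prod-agree-off (f ∘ from) (g ∘ from) (to 0#) agree ⟩
    f (from (to 0#)) * ∏ g           ≡⟨ cong (λ z → f z * ∏ g) from-to0 ⟩
    f 0# * ∏ g                       ∎
    where
    from-to0 : from (to 0#) ≡ 0#
    from-to0 = strictlyInverseʳ 0#
    agree : ∀ j → ¬ j ≡ to 0# → f (from j) ≡ g (from j)
    agree j j≢i = f≗g (from j) (λ e → j≢i (trans (sym (strictlyInverseˡ j)) (cong to e)))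

  orOne : F → F
  orOne y with y ≟ 0#
  ... | yes _ = 1#
  ... | no  _ = y

  orOne≢0 : ∀ y → ¬ orOne y ≡ 0#
  orOne≢0 y with y ≟ 0#
  ... | yes _ = λ 1≡0 → 0≢1 (sym 1≡0)
  ... | no y≢0 = y≢0

  orOne-0# : orOne 0# ≡ 1#
  orOne-0# with 0# ≟ 0#
  ... | yes _ = refl
  ... | no 0≢0 = ⊥-elim (0≢0 refl)

  orOne-≢0 : ∀ {y} → ¬ y ≡ 0# → orOne y ≡ y
  orOne-≢0 {y} y≢0 with y ≟ 0#
  ... | yes y≡0 = ⊥-elim (y≢0 y≡0)
  ... | no  _   = refl

  pow-card-≢0 : ∀ {a} → ¬ a ≡ 0# → pow a (q ℕ.^ n) ≡ a
  pow-card-≢0 {a} a≢0 = *-cancelʳ (prod≢0 _ (orOne≢0 ∘ from)) (begin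
    pow a (q ℕ.^ n) * ∏ orOne       ≡⟨ cong (_* ∏ orOne) (sym (prod-const (q ℕ.^ n) a)) ⟩
    ∏ (λ _ → a) * ∏ orOne           ≡⟨ sym (∑-distrib-+ (λ _ → a) (orOne ∘ from)) ⟩
    ∏ (λ y → a * orOne y)           ≡⟨ sym (*-identityˡ _) ⟩
    1# * ∏ (λ y → a * orOne y)      ≡⟨ cong (_* ∏ (λ y → a * orOne y)) (sym orOne-a*0) ⟩
    orOne (a * 0#) * ∏ (λ y → a * orOne y)
                                    ≡⟨ ∏-agree-off-zero (λ y → a * orOne y) (λ y → orOne (a * y)) scaled ⟩
    a * orOne 0# * ∏ (λ y → orOne (a * y))
                                    ≡⟨ cong₂ (λ u v → a * u * v) orOne-0# (∏-scale a≢0 orOne) ⟩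
    a * 1# * ∏ orOne                ≡⟨ cong (_* ∏ orOne) (*-identityʳ a) ⟩
    a * ∏ orOne                     ∎)
    where
    orOne-a*0 : orOne (a * 0#) ≡ 1#
    orOne-a*0 = trans (cong orOne (zeroʳ a)) orOne-0#
    scaled : ∀ y → ¬ y ≡ 0# → a * orOne y ≡ orOne (a * y)
    scaled y y≢0 = trans (cong (a *_) (orOne-≢0 y≢0)) (sym (orOne-≢0 (x*y≢0 a≢0 y≢0)))

  pow-card : ∀ x → pow x (q ℕ.^ n) ≡ x
  pow-card x with x ≟ 0#
  ... | no  x≢0 = pow-card-≢0 x≢0
  ... | yes refl = pow-0# (q ℕ.^ n) (to 0#)
    where
    pow-0# : ∀ m → Fin m → pow 0# m ≡ 0#
    pow-0# (suc m) _ = zeroˡ _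

module FrobeniusPeriodicity {q n′ : ℕ} (𝔽 : FiniteField q (suc n′)) where
  open FF 𝔽
  open FieldProperties 𝔽
  open FermatLittleTheorem 𝔽 using (pow-card)
  open ≡-Reasoning

  φ^-multiple-of-n : ∀ c x → φ^ (c ℕ.* suc n′) x ≡ x
  φ^-multiple-of-n zero    x = refl
  φ^-multiple-of-n (suc c) x = begin
    φ^ (suc n′ ℕ.+ c ℕ.* suc n′) x       ≡⟨ sym (φ^-+ (suc n′) _ x) ⟩
    φ^ (suc n′) (φ^ (c ℕ.* suc n′) x)    ≡⟨ cong (φ^ (suc n′)) (φ^-multiple-of-n c x) ⟩
    φ^ (suc n′) x                        ≡⟨ φ^-pow (suc n′) x ⟩
    pow x (q ℕ.^ suc n′)                 ≡⟨ pow-card x ⟩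
    x                                    ∎

  φ^-injective : ∀ c {x y} → φ^ c x ≡ φ^ c y → x ≡ y
  φ^-injective c {x} {y} eq = begin
    x                            ≡⟨ sym (φ^-multiple-of-n c x) ⟩
    φ^ (c ℕ.* suc n′) x          ≡⟨ cong (λ m → φ^ m x) c*n≡c*n′+c ⟩
    φ^ (c ℕ.* n′ ℕ.+ c) x        ≡⟨ sym (φ^-+ (c ℕ.* n′) c x) ⟩
    φ^ (c ℕ.* n′) (φ^ c x)       ≡⟨ cong (φ^ (c ℕ.* n′)) eq ⟩
    φ^ (c ℕ.* n′) (φ^ c y)       ≡⟨ φ^-+ (c ℕ.* n′) c y ⟩
    φ^ (c ℕ.* n′ ℕ.+ c) y        ≡⟨ cong (λ m → φ^ m y) (sym c*n≡c*n′+c) ⟩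
    φ^ (c ℕ.* suc n′) y          ≡⟨ φ^-multiple-of-n c y ⟩
    y                            ∎
    where
    c*n≡c*n′+c : c ℕ.* suc n′ ≡ c ℕ.* n′ ℕ.+ c
    c*n≡c*n′+c = trans (ℕ.*-suc c n′) (ℕ.+-comm c (c ℕ.* n′))

  φ^-frob : ∀ a b t z → + a ℤ.+ t ≡ + b → φ^ a (frob t z) ≡ φ^ b z
  φ^-frob a b (+ k) z a+k≡b = trans (φ^-+ a k z)
    (cong (λ m → φ^ m z) (ℤ.+-injective (trans (sym (ℤ.pos-+ a k)) a+k≡b)))
  φ^-frob a b -[1+ k ] z a-k-1≡b = begin
    φ^ a (φ^ (suc k ℕ.* n′) z)              ≡⟨ φ^-+ a _ z ⟩
    φ^ (a ℕ.+ suc k ℕ.* n′) z               ≡⟨ cong (λ m → φ^ (m ℕ.+ suc k ℕ.* n′) z) a≡b+k+1 ⟩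
    φ^ (b ℕ.+ suc k ℕ.+ suc k ℕ.* n′) z     ≡⟨ cong (λ m → φ^ m z) exponent ⟩
    φ^ (b ℕ.+ suc k ℕ.* suc n′) z           ≡⟨ sym (φ^-+ b _ z) ⟩
    φ^ b (φ^ (suc k ℕ.* suc n′) z)          ≡⟨ cong (φ^ b) (φ^-multiple-of-n (suc k) z) ⟩
    φ^ b z                                  ∎
    where
    a≡b+k+1 : a ≡ b ℕ.+ suc k
    a≡b+k+1 = ℤ.+-injective (begin
      + a                                   ≡⟨ sub-add (+ a) (+ suc k) ⟩
      + a ℤ.+ -[1+ k ] ℤ.+ + suc k          ≡⟨ cong (ℤ._+ + suc k) a-k-1≡b ⟩
      + b ℤ.+ + suc k                       ≡⟨ sym (ℤ.pos-+ b (suc k)) ⟩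
      + (b ℕ.+ suc k)                       ∎)
      where
      sub-add : ∀ i j → i ≡ i ℤ.+ negℤ j ℤ.+ j
      sub-add = solve-∀
    exponent : b ℕ.+ suc k ℕ.+ suc k ℕ.* n′ ≡ b ℕ.+ suc k ℕ.* suc n′
    exponent = trans (ℕ.+-assoc b (suc k) _) (cong (b ℕ.+_) (sym (ℕ.*-suc (suc k) n′)))

  frob≢0 : ∀ t {x} → ¬ x ≡ 0# → ¬ frob t x ≡ 0#
  frob≢0 (+ k)    = φ^≢0 k
  frob≢0 -[1+ k ] = φ^≢0 (suc k ℕ.* n′)

vec₄-cong : ∀ {A : Set} {a₁ a₂ a₃ a₄ b₁ b₂ b₃ b₄ : A} →
            a₁ ≡ b₁ → a₂ ≡ b₂ → a₃ ≡ b₃ → a₄ ≡ b₄ →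
            (a₁ ∷ a₂ ∷ a₃ ∷ a₄ ∷ []) ≡ (b₁ ∷ b₂ ∷ b₃ ∷ b₄ ∷ [])
vec₄-cong refl refl refl refl = refl

module DiagonalMatrices {q n : ℕ} (𝔽 : FiniteField q n) where
  open FF 𝔽
  open FieldProperties 𝔽

  inner : ∀ {m} → Vec F m → Vec F m → F
  inner u v = foldr (λ _ → F) _+_ 0# (zipWith _*_ u v)

  inner-zeroˡ : ∀ {m} (v : Vec F m) → inner (replicate m 0#) v ≡ 0#
  inner-zeroˡ []      = refl
  inner-zeroˡ (x ∷ v) = trans (cong₂ _+_ (zeroˡ x) (inner-zeroˡ v)) (+-identityˡ 0#)

  inner-unit : ∀ {m} (i : Fin m) a (v : Vec F m) → inner (replicate m 0# [ i ]≔ a) v ≡ a * lookup v i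
  inner-unit zero    a (x ∷ v) = trans (cong (_+_ (a * x)) (inner-zeroˡ v)) (+-identityʳ (a * x))
  inner-unit (suc i) a (x ∷ v) = trans (cong₂ _+_ (zeroˡ x) (inner-unit i a v)) (+-identityˡ _)

  dot-comm : ∀ u v → dot u v ≡ dot v u
  dot-comm u v = cong (foldr (λ _ → F) _+_ 0#) (zipWith-comm *-comm u v)

  ⊗-rows : ∀ A B → A ⊗ B ≡ map (transpose B ⊙_) A
  ⊗-rows A B = map-cong (λ row → map-cong (dot-comm row) (transpose B)) A

  diag : F → F → F → F → Mat
  diag a b c d = (0v [ 0F ]≔ a) ∷ (0v [ 1F ]≔ b) ∷ (0v [ 2F ]≔ c) ∷ (0v [ 3F ]≔ d) ∷ []

  diag-⊙ : ∀ a b c d x y z t →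
           diag a b c d ⊙ (x ∷ y ∷ z ∷ t ∷ []) ≡ (a * x ∷ b * y ∷ c * z ∷ d * t ∷ [])
  diag-⊙ a b c d x y z t =
    vec₄-cong (inner-unit 0F a v) (inner-unit 1F b v) (inner-unit 2F c v) (inner-unit 3F d v)
    where v = x ∷ y ∷ z ∷ t ∷ []

  diag-⊗ : ∀ a b c d a′ b′ c′ d′ →
           diag a b c d ⊗ diag a′ b′ c′ d′ ≡ diag (a * a′) (b * b′) (c * c′) (d * d′)
  diag-⊗ a b c d a′ b′ c′ d′ = trans (⊗-rows (diag a b c d) (diag a′ b′ c′ d′)) (vec₄-cong
    (trans (diag-⊙ a′ b′ c′ d′ a 0# 0# 0#) (vec₄-cong (*-comm a′ a) (zeroʳ b′) (zeroʳ c′) (zeroʳ d′)))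
    (trans (diag-⊙ a′ b′ c′ d′ 0# b 0# 0#) (vec₄-cong (zeroʳ a′) (*-comm b′ b) (zeroʳ c′) (zeroʳ d′)))
    (trans (diag-⊙ a′ b′ c′ d′ 0# 0# c 0#) (vec₄-cong (zeroʳ a′) (zeroʳ b′) (*-comm c′ c) (zeroʳ d′)))
    (trans (diag-⊙ a′ b′ c′ d′ 0# 0# 0# d) (vec₄-cong (zeroʳ a′) (zeroʳ b′) (zeroʳ c′) (*-comm d′ d))))

  diag-invertible : ∀ {a b c d} → ¬ a ≡ 0# → ¬ b ≡ 0# → ¬ c ≡ 0# → ¬ d ≡ 0# →
                    Invertible (diag a b c d)
  diag-invertible {a} {b} {c} {d} a≢0 b≢0 c≢0 d≢0 = diag (a ⁻¹) (b ⁻¹) (c ⁻¹) (d ⁻¹) ,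
    trans (diag-⊗ _ _ _ _ _ _ _ _) (cong-diag (⁻¹-inverse a a≢0) (⁻¹-inverse b b≢0) (⁻¹-inverse c c≢0) (⁻¹-inverse d d≢0)) ,
    trans (diag-⊗ _ _ _ _ _ _ _ _) (cong-diag (⁻¹-inverseˡ a≢0) (⁻¹-inverseˡ b≢0) (⁻¹-inverseˡ c≢0) (⁻¹-inverseˡ d≢0))
    where
    cong-diag : ∀ {a b c d a′ b′ c′ d′} → a ≡ a′ → b ≡ b′ → c ≡ c′ → d ≡ d′ → diag a b c d ≡ diag a′ b′ c′ d′
    cong-diag refl refl refl refl = refl

module DiagonalEquivalence {q n : ℕ} (𝔽 : FiniteField q n) where
  open FF 𝔽
  open FieldProperties 𝔽
  open DiagonalMatrices 𝔽
  open ≡-Reasoning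

  point : F → F → F → ℕ → ℕ → F → F → V4
  point a b c I J x y = x ∷ y ∷ (φ^ I x + a * φ^ J y) ∷ (φ^ J x + b * φ^ I y + c * φ^ J y) ∷ []

  φ^-twist : ∀ k {κ μ e e′} → κ * e ≡ e′ * φ^ k μ → ∀ z → κ * (e * φ^ k z) ≡ e′ * φ^ k (μ * z)
  φ^-twist k {κ} {μ} {e} {e′} κe≡e′μ z = begin
    κ * (e * φ^ k z)         ≡⟨ sym (*-assoc κ e _) ⟩
    κ * e * φ^ k z           ≡⟨ cong (_* φ^ k z) κe≡e′μ ⟩
    e′ * φ^ k μ * φ^ k z     ≡⟨ *-assoc e′ _ _ ⟩
    e′ * (φ^ k μ * φ^ k z)   ≡⟨ cong (e′ *_) (sym (φ^-* k μ z)) ⟩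
    e′ * φ^ k (μ * z)        ∎

  U-ΓLEquivalent-diag : ∀ {α β γ α̅ β̅ γ̅} I J κ μ → ¬ κ ≡ 0# → ¬ μ ≡ 0# →
    φ^ I κ * α ≡ α̅ * φ^ J μ → φ^ J κ * β ≡ β̅ * φ^ I μ → φ^ J κ * γ ≡ γ̅ * φ^ J μ →
    ΓLEquivalent (U α β γ I J) (U α̅ β̅ γ̅ I J)
  U-ΓLEquivalent-diag {α} {β} {γ} {α̅} {β̅} {γ̅} I J κ μ κ≢0 μ≢0 eα eβ eγ =
    id , N , id-isFieldAut , N-invertible , forward , backward
    where
    N : Mat
    N = diag κ μ (φ^ I κ) (φ^ J κ)

    id-isFieldAut : IsFieldAut id
    id-isFieldAut = (λ _ _ → refl) , (λ _ _ → refl) , refl , id , (λ _ → refl) , (λ _ → refl)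

    N-invertible : Invertible N
    N-invertible = diag-invertible κ≢0 μ≢0 (φ^≢0 I κ≢0) (φ^≢0 J κ≢0)

    N-point : ∀ x y → N ⊙ point α β γ I J x y ≡ point α̅ β̅ γ̅ I J (κ * x) (μ * y)
    N-point x y = trans (diag-⊙ _ _ _ _ _ _ _ _) (vec₄-cong refl refl third fourth)
      where
      third : φ^ I κ * (φ^ I x + α * φ^ J y) ≡ φ^ I (κ * x) + α̅ * φ^ J (μ * y)
      third = trans (distribˡ _ _ _) (cong₂ _+_ (sym (φ^-* I κ x)) (φ^-twist J eα y))
      fourth : φ^ J κ * (φ^ J x + β * φ^ I y + γ * φ^ J y)
             ≡ φ^ J (κ * x) + β̅ * φ^ I (μ * y) + γ̅ * φ^ J (μ * y)
      fourth = trans (distribˡ _ _ _) (cong₂ _+_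
        (trans (distribˡ _ _ _) (cong₂ _+_ (sym (φ^-* J κ x)) (φ^-twist I eβ y)))
        (φ^-twist J eγ y))

    forward : ∀ u → U α β γ I J u → U α̅ β̅ γ̅ I J (N ⊙ map id u)
    forward _ (x , y , refl) = κ * x , μ * y , N-point x y

    backward : ∀ v → U α̅ β̅ γ̅ I J v → ∃ λ u → U α β γ I J u × v ≡ N ⊙ map id u
    backward _ (x , y , refl) = point α β γ I J (κ ⁻¹ * x) (μ ⁻¹ * y) , (_ , _ , refl) ,
      sym (trans (N-point _ _) (cong₂ (point α̅ β̅ γ̅ I J) (*-⁻¹-cancelˡ κ≢0 x) (*-⁻¹-cancelˡ μ≢0 y)))

module ExponentArithmetic (I J : ℕ) where

  K : ℤ
  K = + J -ℤ + I

  2I 2J I+J : ℕ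
  2I  = I ℕ.+ I
  2J  = J ℕ.+ J
  I+J = I ℕ.+ J

  I+K≡J : + I ℤ.+ K ≡ + J
  I+K≡J = identity (+ I) (+ J)
    where
    identity : ∀ i j → i ℤ.+ (j -ℤ i) ≡ j
    identity = solve-∀

  2I+K≡I+J : + 2I ℤ.+ K ≡ + I+J
  2I+K≡I+J = trans (cong (ℤ._+ K) (ℤ.pos-+ I I)) (trans (identity (+ I) (+ J)) (sym (ℤ.pos-+ I J)))
    where
    identity : ∀ i j → i ℤ.+ i ℤ.+ (j -ℤ i) ≡ i ℤ.+ j
    identity = solve-∀

  I+J+K≡2J : + I+J ℤ.+ K ≡ + 2J
  I+J+K≡2J = trans (cong (ℤ._+ K) (ℤ.pos-+ I J)) (trans (identity (+ I) (+ J)) (sym (ℤ.pos-+ J J)))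
    where
    identity : ∀ i j → i ℤ.+ j ℤ.+ (j -ℤ i) ≡ j ℤ.+ j
    identity = solve-∀

  2I+K-I≡J : + 2I ℤ.+ (K -ℤ + I) ≡ + J
  2I+K-I≡J = trans (cong (ℤ._+ (K -ℤ + I)) (ℤ.pos-+ I I)) (identity (+ I) (+ J))
    where
    identity : ∀ i j → i ℤ.+ i ℤ.+ ((j -ℤ i) -ℤ i) ≡ j
    identity = solve-∀

  2I-I≡I : + 2I ℤ.+ negℤ (+ I) ≡ + I
  2I-I≡I = trans (cong (ℤ._+ negℤ (+ I)) (ℤ.pos-+ I I)) (identity (+ I))
    where
    identity : ∀ i → i ℤ.+ i ℤ.+ negℤ i ≡ i
    identity = solve-∀

module Corollary4p10Witness {q n′ : ℕ} (𝔽 : FiniteField q (suc n′)) where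
  open FF 𝔽
  open FieldProperties 𝔽
  open FrobeniusPeriodicity 𝔽
  open ≡-Reasoning

  module Construction
    (α β γ α̅ β̅ γ̅ : F) (α≢0 : ¬ α ≡ 0#) (α̅≢0 : ¬ α̅ ≡ 0#) (β̅≢0 : ¬ β̅ ≡ 0#) (γ̅≢0 : ¬ γ̅ ≡ 0#)
    (I J : ℕ) (ρ ν w : F)
    (ρ-def : frob (+ J -ℤ + I) ρ ≡ frob ((+ J -ℤ + I) -ℤ + I) (β / β̅) * frob (negℤ (+ I)) (α̅ / α))
    (ν-def : frob (+ J -ℤ + I) ν ≡ frob (negℤ (+ I)) ((γ * α̅) / (γ̅ * α)))
    (ρ≡ν^q^K+1 : ρ ≡ frob (+ J -ℤ + I) ν * ν)
    (w≢0 : ¬ w ≡ 0#) (ν≡w^q^K/w : ν ≡ frob (+ J -ℤ + I) w / w) where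

    open ExponentArithmetic I J

    W : F
    W = frob K w

    W≢0 : ¬ W ≡ 0#
    W≢0 = frob≢0 K w≢0

    A : F
    A = α * α̅ ⁻¹

    κ : F
    κ = W ⁻¹

    μ : F
    μ = frob (negℤ (+ J)) A * w ⁻¹

    κ≢0 : ¬ κ ≡ 0#
    κ≢0 = ⁻¹≢0 W≢0

    μ≢0 : ¬ μ ≡ 0#
    μ≢0 = x*y≢0 (frob≢0 (negℤ (+ J)) (x*y≢0 α≢0 (⁻¹≢0 α̅≢0))) (⁻¹≢0 w≢0)

    A*α̅≡α : A * α̅ ≡ α
    A*α̅≡α = ⁻¹-*-cancelʳ α̅≢0 α

    ν*w≡W : ν * w ≡ W
    ν*w≡W = trans (cong (_* w) ν≡w^q^K/w) (⁻¹-*-cancelʳ w≢0 W)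

    φ^J-μ*w : φ^ J μ * φ^ J w ≡ A
    φ^J-μ*w = trans (φ^-*-≡ J (⁻¹-*-cancelʳ w≢0 _)) (φ^-frob J 0 (negℤ (+ J)) A (ℤ.+-inverseʳ (+ J)))

    φ^I-κ*φ^J-w : φ^ I κ * φ^ J w ≡ 1#
    φ^I-κ*φ^J-w = trans (cong (φ^ I κ *_) (sym (φ^-frob I J K w I+K≡J))) (φ^-⁻¹-inverseˡ I W≢0)

    twist-α : φ^ I κ * α ≡ α̅ * φ^ J μ
    twist-α = *-cancelʳ (φ^≢0 J w≢0) (begin
      φ^ I κ * α * φ^ J w        ≡⟨ solve 3 (λ x y z → (x ⊕ y) ⊕ z ⊜ (x ⊕ z) ⊕ y) refl (φ^ I κ) α (φ^ J w) ⟩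
      φ^ I κ * φ^ J w * α        ≡⟨ cong (_* α) φ^I-κ*φ^J-w ⟩
      1# * α                     ≡⟨ *-identityˡ α ⟩
      α                          ≡⟨ sym A*α̅≡α ⟩
      A * α̅                      ≡⟨ cong (_* α̅) (sym φ^J-μ*w) ⟩
      φ^ J μ * φ^ J w * α̅        ≡⟨ solve 3 (λ x y z → (x ⊕ y) ⊕ z ⊜ (z ⊕ x) ⊕ y) refl (φ^ J μ) (φ^ J w) α̅ ⟩
      α̅ * φ^ J μ * φ^ J w        ∎)

    φ^J-ν : φ^ J ν * (γ̅ * α) ≡ γ * α̅
    φ^J-ν = begin
      φ^ J ν * (γ̅ * α)                                    ≡⟨ cong (_* (γ̅ * α)) (sym (φ^-frob I J K ν I+K≡J)) ⟩
      φ^ I (frob K ν) * (γ̅ * α)                           ≡⟨ cong (λ x → φ^ I x * (γ̅ * α)) ν-def ⟩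
      φ^ I (frob (negℤ (+ I)) ((γ * α̅) / (γ̅ * α))) * (γ̅ * α)
                                                          ≡⟨ cong (_* (γ̅ * α)) (φ^-frob I 0 (negℤ (+ I)) _ (ℤ.+-inverseʳ (+ I))) ⟩
      (γ * α̅) / (γ̅ * α) * (γ̅ * α)                         ≡⟨ ⁻¹-*-cancelʳ (x*y≢0 γ̅≢0 α≢0) (γ * α̅) ⟩
      γ * α̅                                               ∎

    twist-γ : φ^ J κ * γ ≡ γ̅ * φ^ J μ
    twist-γ = *-cancelʳ (x*y≢0 (φ^≢0 J W≢0) α̅≢0) (begin
      φ^ J κ * γ * (φ^ J W * α̅)             ≡⟨ solve 4 (λ x y z t → (x ⊕ y) ⊕ (z ⊕ t) ⊜ (x ⊕ z) ⊕ (y ⊕ t)) refl (φ^ J κ) γ (φ^ J W) α̅ ⟩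
      φ^ J κ * φ^ J W * (γ * α̅)             ≡⟨ cong (_* (γ * α̅)) (φ^-⁻¹-inverseˡ J W≢0) ⟩
      1# * (γ * α̅)                          ≡⟨ *-identityˡ _ ⟩
      γ * α̅                                 ≡⟨ sym φ^J-ν ⟩
      φ^ J ν * (γ̅ * α)                      ≡⟨ cong (λ x → φ^ J ν * (γ̅ * x)) (sym A*α̅≡α) ⟩
      φ^ J ν * (γ̅ * (A * α̅))                ≡⟨ cong (λ x → φ^ J ν * (γ̅ * (x * α̅))) (sym φ^J-μ*w) ⟩
      φ^ J ν * (γ̅ * (φ^ J μ * φ^ J w * α̅))
        ≡⟨ solve 5 (λ a b c d e → a ⊕ (b ⊕ ((c ⊕ d) ⊕ e)) ⊜ (b ⊕ c) ⊕ ((a ⊕ d) ⊕ e)) refl (φ^ J ν) γ̅ (φ^ J μ) (φ^ J w) α̅ ⟩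
      γ̅ * φ^ J μ * (φ^ J ν * φ^ J w * α̅)    ≡⟨ cong (λ x → γ̅ * φ^ J μ * (x * α̅)) (φ^-*-≡ J ν*w≡W) ⟩
      γ̅ * φ^ J μ * (φ^ J W * α̅)             ∎)

    φ^-ρ : φ^ 2J ν * φ^ I+J ν ≡ φ^ J (β / β̅) * φ^ I (α̅ / α)
    φ^-ρ = begin
      φ^ 2J ν * φ^ I+J ν             ≡⟨ cong (_* φ^ I+J ν) (sym (φ^-frob I+J 2J K ν I+J+K≡2J)) ⟩
      φ^ I+J (frob K ν) * φ^ I+J ν    ≡⟨ φ^-*-≡ I+J (sym ρ≡ν^q^K+1) ⟩
      φ^ I+J ρ                              ≡⟨ sym (φ^-frob 2I I+J K ρ 2I+K≡I+J) ⟩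
      φ^ 2I (frob K ρ)                     ≡⟨ cong (φ^ 2I) ρ-def ⟩
      φ^ 2I (frob (K -ℤ + I) (β / β̅) * frob (negℤ (+ I)) (α̅ / α))
                                                  ≡⟨ φ^-* 2I _ _ ⟩
      φ^ 2I (frob (K -ℤ + I) (β / β̅)) * φ^ 2I (frob (negℤ (+ I)) (α̅ / α))
                                                  ≡⟨ cong₂ _*_ (φ^-frob 2I J (K -ℤ + I) _ 2I+K-I≡J) (φ^-frob 2I I (negℤ (+ I)) _ 2I-I≡I) ⟩
      φ^ J (β / β̅) * φ^ I (α̅ / α)                 ∎

    φ^-ρ-cleared : φ^ 2J ν * φ^ I+J ν * (φ^ J β̅ * φ^ I α) ≡ φ^ J β * φ^ I α̅
    φ^-ρ-cleared = begin
      φ^ 2J ν * φ^ I+J ν * (φ^ J β̅ * φ^ I α)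
                                                  ≡⟨ cong (_* (φ^ J β̅ * φ^ I α)) φ^-ρ ⟩
      φ^ J (β / β̅) * φ^ I (α̅ / α) * (φ^ J β̅ * φ^ I α)
        ≡⟨ solve 4 (λ a b c d → (a ⊕ b) ⊕ (c ⊕ d) ⊜ (a ⊕ c) ⊕ (b ⊕ d)) refl (φ^ J (β / β̅)) (φ^ I (α̅ / α)) (φ^ J β̅) (φ^ I α) ⟩
      φ^ J (β / β̅) * φ^ J β̅ * (φ^ I (α̅ / α) * φ^ I α)
        ≡⟨ cong₂ _*_ (φ^-*-≡ J (⁻¹-*-cancelʳ β̅≢0 β)) (φ^-*-≡ I (⁻¹-*-cancelʳ α≢0 α̅)) ⟩
      φ^ J β * φ^ I α̅                             ∎

    φ^2J-W : φ^ 2J W ≡ φ^ 2J ν * (φ^ I+J ν * φ^ I+J w)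
    φ^2J-W = begin
      φ^ 2J W                                         ≡⟨ sym (φ^-*-≡ 2J ν*w≡W) ⟩
      φ^ 2J ν * φ^ 2J w                        ≡⟨ cong (φ^ 2J ν *_) (sym (φ^-frob I+J 2J K w I+J+K≡2J)) ⟩
      φ^ 2J ν * φ^ I+J W                        ≡⟨ cong (φ^ 2J ν *_) (sym (φ^-*-≡ I+J ν*w≡W)) ⟩
      φ^ 2J ν * (φ^ I+J ν * φ^ I+J w)     ∎

    φ^I+J-μ*w : φ^ I+J μ * φ^ I+J w ≡ φ^ I A
    φ^I+J-μ*w = begin
      φ^ I+J μ * φ^ I+J w           ≡⟨ sym (cong₂ _*_ (φ^-+ I J μ) (φ^-+ I J w)) ⟩
      φ^ I (φ^ J μ) * φ^ I (φ^ J w)             ≡⟨ φ^-*-≡ I φ^J-μ*w ⟩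
      φ^ I A                                    ∎

    twist-β-lifted : φ^ 2J κ * φ^ J β ≡ φ^ J β̅ * φ^ I+J μ
    twist-β-lifted = *-cancelʳ (x*y≢0 (φ^≢0 2J W≢0) (x*y≢0 (φ^≢0 I+J w≢0) (φ^≢0 I α̅≢0))) (begin
      φ^ 2J κ * b * (φ^ 2J W * (v * ā))
        ≡⟨ solve 5 (λ k x y m z → (k ⊕ x) ⊕ (y ⊕ (m ⊕ z)) ⊜ (k ⊕ y) ⊕ ((x ⊕ z) ⊕ m)) refl (φ^ 2J κ) b (φ^ 2J W) v ā ⟩
      φ^ 2J κ * φ^ 2J W * (b * ā * v)        ≡⟨ cong (_* (b * ā * v)) (φ^-⁻¹-inverseˡ 2J W≢0) ⟩
      1# * (b * ā * v)                       ≡⟨ *-identityˡ _ ⟩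
      b * ā * v                              ≡⟨ cong (_* v) (sym φ^-ρ-cleared) ⟩
      ν₂ * ν₁ * (b̄ * a) * v                  ≡⟨ cong (λ x → ν₂ * ν₁ * (b̄ * x) * v) (sym (φ^-*-≡ I A*α̅≡α)) ⟩
      ν₂ * ν₁ * (b̄ * (φ^ I A * ā)) * v       ≡⟨ cong (λ x → ν₂ * ν₁ * (b̄ * (x * ā)) * v) (sym φ^I+J-μ*w) ⟩
      ν₂ * ν₁ * (b̄ * (φ^ I+J μ * v * ā)) * v
        ≡⟨ solve 7 (λ p r x m y z t → ((p ⊕ r) ⊕ (x ⊕ ((m ⊕ y) ⊕ z))) ⊕ t ⊜ (x ⊕ m) ⊕ ((p ⊕ (r ⊕ t)) ⊕ (y ⊕ z)))
                 refl ν₂ ν₁ b̄ (φ^ I+J μ) v ā v ⟩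
      b̄ * φ^ I+J μ * (ν₂ * (ν₁ * v) * (v * ā))  ≡⟨ cong (λ x → b̄ * φ^ I+J μ * (x * (v * ā))) (sym φ^2J-W) ⟩
      b̄ * φ^ I+J μ * (φ^ 2J W * (v * ā))     ∎)
      where
      a ā b b̄ ν₁ ν₂ v : F
      a  = φ^ I α
      ā  = φ^ I α̅
      b  = φ^ J β
      b̄  = φ^ J β̅
      ν₁ = φ^ I+J ν
      ν₂ = φ^ 2J ν
      v  = φ^ I+J w

    twist-β : φ^ J κ * β ≡ β̅ * φ^ I μ
    twist-β = φ^-injective J (begin
      φ^ J (φ^ J κ * β)                ≡⟨ φ^-* J _ β ⟩
      φ^ J (φ^ J κ) * φ^ J β           ≡⟨ cong (_* φ^ J β) (φ^-+ J J κ) ⟩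
      φ^ 2J κ * φ^ J β          ≡⟨ twist-β-lifted ⟩
      φ^ J β̅ * φ^ I+J μ          ≡⟨ cong (φ^ J β̅ *_) (sym (trans (φ^-comm J I μ) (φ^-+ I J μ))) ⟩
      φ^ J β̅ * φ^ J (φ^ I μ)           ≡⟨ sym (φ^-* J β̅ _) ⟩
      φ^ J (β̅ * φ^ I μ)                ∎)

corollary4p10 : (q n : ℕ) → PrimePower q → 1 ≤ n → (𝔽 : FiniteField q n) →
    let open FF 𝔽 in
    (α β γ α̅ β̅ γ̅ : F) →
    ¬ (α ≡ 0#) → ¬ (β ≡ 0#) → ¬ (γ ≡ 0#) → ¬ (α̅ ≡ 0#) → ¬ (β̅ ≡ 0#) → ¬ (γ̅ ≡ 0#) →
    (I J : ℕ) → ¬ (I ≡ J) → I < n ∸ 1 → J < n ∸ 1 →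
    Scattered (U α β γ I J) → Scattered (U α̅ β̅ γ̅ I J) →
    (ρ ν : F) →
    frob (+ J -ℤ + I) ρ ≡ frob ((+ J -ℤ + I) -ℤ + I) (β / β̅) * frob (negℤ (+ I)) (α̅ / α) →
    frob (+ J -ℤ + I) ν ≡ frob (negℤ (+ I)) ((γ * α̅) / (γ̅ * α)) →
    ρ ≡ frob (+ J -ℤ + I) ν * ν →
    (∃ λ w → ¬ (w ≡ 0#) × ν ≡ frob (+ J -ℤ + I) w / w) →
    ΓLEquivalent (U α β γ I J) (U α̅ β̅ γ̅ I J)
corollary4p10 q (suc n′) _ _ 𝔽 α β γ α̅ β̅ γ̅ α≢0 _ _ α̅≢0 β̅≢0 γ̅≢0 I J _ _ _ _ _
              ρ ν ρ-def ν-def ρ≡ν^q^K+1 (w , w≢0 , ν≡w^q^K/w) =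
  U-ΓLEquivalent-diag I J κ μ κ≢0 μ≢0 twist-α twist-β twist-γ
  where
  open DiagonalEquivalence 𝔽
  open Corollary4p10Witness.Construction 𝔽 α β γ α̅ β̅ γ̅ α≢0 α̅≢0 β̅≢0 γ̅≢0 I J ρ ν w
         ρ-def ν-def ρ≡ν^q^K+1 w≢0 ν≡w^q^K/w
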